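{- Let $(S_1,S_2)$ be an Euler pair. Then for every $n\geqslant 0$, $$q_e(S_2;n)-q_o(S_2;n)=p_e(S_1;n)-p_o(S_1;n).$$
   Context: For a set $S$ of positive integers, $p(S;n)$ is the number of partitions of $n$ with all parts in $S$, and $q(S;n)$ is the number of partitions of $n$ into distinct parts, all in $S$. $p_e(S;n)$ (resp. $p_o(S;n)$) is the number of partitions of $n$ with parts in $S$ having an even (resp. odd) number of parts; $q_e(S;n)$ (resp. $q_o(S;n)$) is the number of partitions of $n$ into distinct parts in $S$ having an even (resp. odd) number of parts. A pair $(S_1,S_2)$ of subsets of the positive integers is an Euler pair if $q(S_1;n)=p(S_2;n)$ for all $n\geqslant 0$. -}

module Defs where

open import Data.Nat using (ℕ; zero; suc; _+_; _*_; _∸_; _≤ᵇ_)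
open import Data.Bool using (Bool; true; false; if_then_else_; not)
open import Relation.Binary.PropositionalEquality using (_≡_)

-- A set S of positive integers is given by its (decidable) characteristic
-- function on ℕ; only values at positive integers matter (0 is never a part).
Subset : Set
Subset = ℕ → Bool

-- ppar S b m n : number of partitions of n whose parts lie in S and are
-- in {1,…,m}, counted with a number of parts whose parity is b
-- (b = false : even number of parts, b = true : odd number of parts).
mutual
  ppar : Subset → Bool → ℕ → ℕ → ℕ
  ppar S b zero    zero    = if b then 0 else 1
  ppar S b zero    (suc n) = 0
  ppar S b (suc m) n       =
    if S (suc m) then pmult S b m (suc m) n n else ppar S b m n

  -- sum over j ≥ 0 with j·k ≤ n of ppar S (b xor j) m (n - j·k);
  -- fuel f bounds the recursion (f = n suffices since k ≥ 1).
  pmult : Subset → Bool → ℕ → ℕ → ℕ → ℕ → ℕ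
  pmult S b m k zero    n = ppar S b m n
  pmult S b m k (suc f) n =
    ppar S b m n + (if k ≤ᵇ n then pmult S (not b) m k f (n ∸ k) else 0)

qpar : Subset → Bool → ℕ → ℕ → ℕ
qpar S b zero    zero    = if b then 0 else 1
qpar S b zero    (suc n) = 0
qpar S b (suc m) n       =
  qpar S b m n +
  (if S (suc m) then (if suc m ≤ᵇ n then qpar S (not b) m (n ∸ suc m) else 0) else 0)

-- Parts of a partition of n are ≤ n, so m = n gives all partitions of n.
p : Subset → ℕ → ℕ
p S n = ppar S false n n + ppar S true n n

pₑ pₒ qₑ qₒ q : Subset → ℕ → ℕ
pₑ S n = ppar S false n n
pₒ S n = ppar S true  n n
qₑ S n = qpar S false n n
qₒ S n = qpar S true  n n
q  S n = qₑ S n + qₒ S n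

EulerPair : Subset → Subset → Set
EulerPair S₁ S₂ = ∀ n → q S₁ n ≡ p S₂ n

-- Writing P_S(s) = ∏_{k∈S} 1/(1 - s xᵏ) and Q_S(s) = ∏_{k∈S} (1 + s xᵏ), where s
-- marks the number of parts, the coefficient of xⁿ in P_S(s) is pₑ(S;n) + s pₒ(S;n)
-- and in Q_S(s) it is qₑ(S;n) + s qₒ(S;n), as long as s² = 1.  Factor by factor,
-- P_S(s) Q_S(-s) = 1.  Taking s = -1 for S₁ and s = 1 for S₂, both
-- Σ (pₑ(S₁;n) - pₒ(S₁;n)) xⁿ and Σ (qₑ(S₂;n) - qₒ(S₂;n)) xⁿ are inverses of the
-- series Σ q(S₁;n) xⁿ = Σ p(S₂;n) xⁿ, and inverses of power series are unique.
module Submission where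

open import Defs
open import Algebra.Bundles using (AbelianGroup)
open import Data.Bool using (Bool; true; false; if_then_else_; not)
open import Data.Integer using (ℤ; +_; _+_; _*_; -_; _-_; 0ℤ; 1ℤ; -1ℤ)
open import Data.Integer.Properties
  using (+-0-abelianGroup; +-identityˡ; +-identityʳ; +-comm; +-assoc;
         *-identityˡ; *-identityʳ; *-zeroʳ; *-comm; pos-+; -1*i≡-i)
open import Data.Integer.Tactic.RingSolver using (solve-∀)
open import Data.Nat as ℕ using (ℕ; zero; suc; _∸_; _≤ᵇ_; _≤_; _<_; _≤′_; ≤′-refl; ≤′-step; s≤s)
import Data.Nat.Properties as ℕ
open import Data.Nat.Induction using (<-rec)
open import Function using (_∘_)
open import Relation.Binary.PropositionalEquality
open ≡-Reasoning

open import Algebra.Properties.Group (AbelianGroup.group +-0-abelianGroup) using (∙-cancelˡ)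

private
  variable
    A : Set
    S : Subset
    b : Bool
    c : ℤ
    i j k m n : ℕ
    f g h h′ : ℕ → ℤ

Series : Set
Series = ℕ → ℤ

sumBelow : ℕ → Series → ℤ
sumBelow zero    h = 0ℤ
sumBelow (suc n) h = sumBelow n h + h n

sumBelow-cong : ∀ n → (∀ {i} → i < n → h i ≡ h′ i) → sumBelow n h ≡ sumBelow n h′
sumBelow-cong zero    eq = refl
sumBelow-cong (suc n) eq = cong₂ _+_ (sumBelow-cong n (eq ∘ ℕ.m<n⇒m<1+n)) (eq ℕ.≤-refl)

sumBelow-zero : ∀ n → sumBelow n (λ _ → 0ℤ) ≡ 0ℤ
sumBelow-zero zero    = refl
sumBelow-zero (suc n) = trans (+-identityʳ _) (sumBelow-zero n)

sumBelow-head : ∀ n → sumBelow (suc n) h ≡ h 0 + sumBelow n (h ∘ suc)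
sumBelow-head {h = h} zero    = +-comm 0ℤ (h 0)
sumBelow-head {h = h} (suc n) =
  trans (cong (_+ h (suc n)) (sumBelow-head n)) (+-assoc (h 0) _ (h (suc n)))

sumBelow-reverse : ∀ n → sumBelow (suc n) (λ i → h (n ∸ i)) ≡ sumBelow (suc n) h
sumBelow-reverse         zero    = refl
sumBelow-reverse {h = h} (suc n) = begin
  sumBelow (suc (suc n)) (λ i → h (suc n ∸ i))    ≡⟨ sumBelow-head (suc n) ⟩
  h (suc n) + sumBelow (suc n) (λ i → h (n ∸ i))  ≡⟨ cong (_+_ (h (suc n))) (sumBelow-reverse n) ⟩
  h (suc n) + sumBelow (suc n) h                  ≡⟨ +-comm (h (suc n)) _ ⟩
  sumBelow (suc (suc n)) h                        ∎

sumBelow-linear : ∀ h c h′ n → sumBelow n (λ i → h i + c * h′ i) ≡ sumBelow n h + c * sumBelow n h′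
sumBelow-linear h c h′ zero    = sym (trans (+-identityˡ _) (*-zeroʳ c))
sumBelow-linear h c h′ (suc n) =
  trans (cong (_+ (h n + c * h′ n)) (sumBelow-linear h c h′ n))
        (regroup (sumBelow n h) (sumBelow n h′) (h n) (h′ n) c)
  where
  regroup : ∀ a a′ x x′ c → (a + c * a′) + (x + c * x′) ≡ (a + x) + c * (a′ + x′)
  regroup = solve-∀

shift : ℕ → Series → Series
shift zero    f n       = f n
shift (suc k) f zero    = 0ℤ
shift (suc k) f (suc n) = shift k f n

shift-below : ∀ f → n < k → shift k f n ≡ 0ℤ
shift-below {zero}  {suc k} f _         = refl
shift-below {suc n} {suc k} f (s≤s n<k) = shift-below f n<k

+-shift-below : ∀ x f → n < k → x + shift k f n ≡ x
+-shift-below x f n<k = trans (cong (_+_ x) (shift-below f n<k)) (+-identityʳ x)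

shift-cong : f ≗ g → shift k f ≗ shift k g
shift-cong {k = zero}  eq n       = eq n
shift-cong {k = suc k} eq zero    = refl
shift-cong {k = suc k} eq (suc n) = shift-cong {k = k} eq n

shift-linear : ∀ f c g k n → shift k (λ i → f i + c * g i) n ≡ shift k f n + c * shift k g n
shift-linear f c g zero    n       = refl
shift-linear f c g (suc k) zero    = sym (trans (+-identityˡ _) (*-zeroʳ c))
shift-linear f c g (suc k) (suc n) = shift-linear f c g k n

shift-pos : ∀ (F : ℕ → ℕ) k n → shift k (λ i → + F i) n ≡ + (if k ≤ᵇ n then F (n ∸ k) else 0)
shift-pos F zero          n       = refl
shift-pos F (suc k)       zero    = refl
shift-pos F (suc zero)    (suc n) = refl
shift-pos F (suc (suc k)) (suc n) = shift-pos F (suc k) n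

mulBinomial : ℤ → ℕ → Series → Series
mulBinomial c k f n = f n + c * shift k f n

mulBinomial-cong : f ≗ g → mulBinomial c k f ≗ mulBinomial c k g
mulBinomial-cong {c = c} {k = k} eq n = cong₂ (λ x y → x + c * y) (eq n) (shift-cong {k = k} eq n)

δ : Series
δ zero    = 1ℤ
δ (suc n) = 0ℤ

infixl 7 _⊛_

_⊛_ : Series → Series → Series
(f ⊛ g) n = sumBelow (suc n) (λ i → f i * g (n ∸ i))

⊛-cong : ∀ {f f′ g g′} → f ≗ f′ → g ≗ g′ → f ⊛ g ≗ f′ ⊛ g′
⊛-cong eqf eqg n = sumBelow-cong (suc n) (λ {i} _ → cong₂ _*_ (eqf i) (eqg (n ∸ i)))

⊛-congˡ : ∀ {f f′} g → f ≗ f′ → f ⊛ g ≗ f′ ⊛ g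
⊛-congˡ g eq = ⊛-cong eq (λ i → refl {x = g i})

⊛-congʳ : ∀ f {g g′} → g ≗ g′ → f ⊛ g ≗ f ⊛ g′
⊛-congʳ f eq = ⊛-cong (λ i → refl {x = f i}) eq

⊛-comm : ∀ f g → f ⊛ g ≗ g ⊛ f
⊛-comm f g n = begin
  (f ⊛ g) n                                           ≡⟨ sumBelow-reverse n ⟨
  sumBelow (suc n) (λ i → f (n ∸ i) * g (n ∸ (n ∸ i))) ≡⟨ sumBelow-cong (suc n) swap ⟩
  (g ⊛ f) n                                           ∎
  where
  swap : i < suc n → f (n ∸ i) * g (n ∸ (n ∸ i)) ≡ g i * f (n ∸ i)
  swap {i} (s≤s i≤n) = trans (cong (λ j → f (n ∸ i) * g j) (ℕ.m∸[m∸n]≡n i≤n)) (*-comm (f (n ∸ i)) (g i))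

⊛-identityˡ : ∀ g → δ ⊛ g ≗ g
⊛-identityˡ g n = begin
  (δ ⊛ g) n                          ≡⟨ sumBelow-head n ⟩
  1ℤ * g n + sumBelow n (λ _ → 0ℤ)   ≡⟨ cong₂ _+_ (*-identityˡ (g n)) (sumBelow-zero n) ⟩
  g n + 0ℤ                           ≡⟨ +-identityʳ (g n) ⟩
  g n                                ∎

⊛-shiftʳ : ∀ f k g → f ⊛ shift k g ≗ shift k (f ⊛ g)
⊛-shiftʳ f zero    g n       = refl
⊛-shiftʳ f (suc k) g zero    = trans (+-identityˡ _) (*-zeroʳ (f 0))
⊛-shiftʳ f (suc k) g (suc n) = begin
  (f ⊛ shift (suc k) g) (suc n)  ≡⟨ cong₂ _+_ (sumBelow-cong (suc n) lower) top ⟩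
  (f ⊛ shift k g) n + 0ℤ         ≡⟨ +-identityʳ _ ⟩
  (f ⊛ shift k g) n              ≡⟨ ⊛-shiftʳ f k g n ⟩
  shift k (f ⊛ g) n              ∎
  where
  lower : i < suc n → f i * shift (suc k) g (suc n ∸ i) ≡ f i * shift k g (n ∸ i)
  lower {i} (s≤s i≤n) = cong (λ j → f i * shift (suc k) g j) (ℕ.+-∸-assoc 1 i≤n)
  top : f (suc n) * shift (suc k) g (n ∸ n) ≡ 0ℤ
  top = trans (cong (λ j → f (suc n) * shift (suc k) g j) (ℕ.n∸n≡0 n)) (*-zeroʳ (f (suc n)))

⊛-mulBinomialʳ : ∀ f c k g → f ⊛ mulBinomial c k g ≗ mulBinomial c k (f ⊛ g)
⊛-mulBinomialʳ f c k g n = begin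
  (f ⊛ mulBinomial c k g) n
    ≡⟨ sumBelow-cong (suc n) (λ {i} _ → distrib (f i) (g (n ∸ i)) c (shift k g (n ∸ i))) ⟩
  sumBelow (suc n) (λ i → f i * g (n ∸ i) + c * (f i * shift k g (n ∸ i)))
    ≡⟨ sumBelow-linear (λ i → f i * g (n ∸ i)) c (λ i → f i * shift k g (n ∸ i)) (suc n) ⟩
  (f ⊛ g) n + c * (f ⊛ shift k g) n
    ≡⟨ cong (λ x → (f ⊛ g) n + c * x) (⊛-shiftʳ f k g n) ⟩
  mulBinomial c k (f ⊛ g) n ∎
  where
  distrib : ∀ a x c y → a * (x + c * y) ≡ a * x + c * (a * y)
  distrib = solve-∀

⊛-mulBinomial-swap : ∀ c k f g → mulBinomial c k f ⊛ g ≗ f ⊛ mulBinomial c k g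
⊛-mulBinomial-swap c k f g n = begin
  (mulBinomial c k f ⊛ g) n  ≡⟨ ⊛-comm (mulBinomial c k f) g n ⟩
  (g ⊛ mulBinomial c k f) n  ≡⟨ ⊛-mulBinomialʳ g c k f n ⟩
  mulBinomial c k (g ⊛ f) n  ≡⟨ mulBinomial-cong {c = c} {k = k} (⊛-comm g f) n ⟩
  mulBinomial c k (f ⊛ g) n  ≡⟨ ⊛-mulBinomialʳ f c k g n ⟨
  (f ⊛ mulBinomial c k g) n  ∎

⊛-cancelʳ : ∀ X Y a → a 0 ≡ 1ℤ → X ⊛ a ≗ Y ⊛ a → X ≗ Y
⊛-cancelʳ X Y a a₀ eq = <-rec (λ n → X n ≡ Y n) step
  where
  lower : Series → ℕ → ℤ
  lower Z n = sumBelow n (λ i → Z i * a (n ∸ i))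
  leading : ∀ Z n → Z n * a (n ∸ n) ≡ Z n
  leading Z n = trans (cong (λ j → Z n * a j) (ℕ.n∸n≡0 n)) (trans (cong (Z n *_) a₀) (*-identityʳ (Z n)))
  step : ∀ n → (∀ {i} → i < n → X i ≡ Y i) → X n ≡ Y n
  step n ih = ∙-cancelˡ (lower X n) (X n) (Y n) (begin
    lower X n + X n              ≡⟨ cong (_+_ (lower X n)) (leading X n) ⟨
    (X ⊛ a) n                    ≡⟨ eq n ⟩
    lower Y n + Y n * a (n ∸ n)  ≡⟨ cong₂ _+_ (sumBelow-cong n (λ {i} i<n → cong (_* a (n ∸ i)) (sym (ih i<n))))
                                              (leading Y n) ⟩
    lower X n + Y n              ∎)

stabilises : {F : ℕ → ℕ → A} → (∀ {m n} → n ≤ m → F (suc m) n ≡ F m n) → n ≤ m → F m n ≡ F n n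
stabilises {F = F} step n≤m = go (ℕ.≤⇒≤′ n≤m)
  where
  go : n ≤′ m → F m n ≡ F n n
  go ≤′-refl      = refl
  go (≤′-step n≤′m) = trans (step (ℕ.≤′⇒≤ n≤′m)) (go n≤′m)

-- Unlike a with-abstraction, this case split does not normalise the goal.
bool-cases : (x : Bool) → (x ≡ false → A) → (x ≡ true → A) → A
bool-cases false on-false on-true = on-false refl
bool-cases true  on-false on-true = on-true refl

-- Every part is at least 1, so any fuel f ≥ n suffices.
pmult-fuel : ∀ f f′ n → n ≤ f → n ≤ f′ → pmult S b m (suc j) f n ≡ pmult S b m (suc j) f′ n
pmult-fuel zero zero _ _ _ = refl
pmult-fuel zero (suc f′) n ℕ.z≤n _ = sym (ℕ.+-identityʳ _)
pmult-fuel (suc f) zero n _ ℕ.z≤n = ℕ.+-identityʳ _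
pmult-fuel {S = S} {b = b} {m = m} {j = j} (suc f) (suc f′) n n≤f n≤f′ with suc j ≤ᵇ n
... | false = refl
... | true  = cong (ppar S b m n ℕ.+_) (pmult-fuel f f′ (n ∸ suc j) (bound n≤f) (bound n≤f′))
  where
  bound : ∀ {f} → n ≤ suc f → n ∸ suc j ≤ f
  bound {f} n≤f = ℕ.≤-trans (ℕ.∸-monoˡ-≤ (suc j) n≤f) (ℕ.m∸n≤m f j)

ppar-suc : ∀ S m → S (suc m) ≡ true → ∀ b n →
  ppar S b (suc m) n ≡ ppar S b m n ℕ.+ (if suc m ≤ᵇ n then ppar S (not b) (suc m) (n ∸ suc m) else 0)
ppar-suc S m eq b zero rewrite eq = sym (ℕ.+-identityʳ _)
ppar-suc S m eq b (suc n) rewrite eq with suc m ≤ᵇ suc n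
... | false = refl
... | true  = cong (ppar S b m (suc n) ℕ.+_) (pmult-fuel n (n ∸ m) _ (ℕ.m∸n≤m n m) ℕ.≤-refl)

pCount qCount : Subset → ℕ → Bool → Series
pCount S m b n = + ppar S b m n
qCount S m b n = + qpar S b m n

pCount-suc : ∀ S m → S (suc m) ≡ true → ∀ b n →
  pCount S (suc m) b n ≡ pCount S m b n + shift (suc m) (pCount S (suc m) (not b)) n
pCount-suc S m eq b n = begin
  + ppar S b (suc m) n               ≡⟨ cong +_ (ppar-suc S m eq b n) ⟩
  + (ppar S b m n ℕ.+ tail)          ≡⟨ pos-+ (ppar S b m n) tail ⟩
  pCount S m b n + + tail            ≡⟨ cong (_+_ (pCount S m b n)) (shift-pos (ppar S (not b) (suc m)) (suc m) n) ⟨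
  pCount S m b n + shift (suc m) (pCount S (suc m) (not b)) n ∎
  where
  tail : ℕ
  tail = if suc m ≤ᵇ n then ppar S (not b) (suc m) (n ∸ suc m) else 0

qCount-suc : ∀ S m → S (suc m) ≡ true → ∀ b n →
  qCount S (suc m) b n ≡ qCount S m b n + shift (suc m) (qCount S m (not b)) n
qCount-suc S m eq b n rewrite eq = begin
  + (qpar S b m n ℕ.+ tail)          ≡⟨ pos-+ (qpar S b m n) tail ⟩
  qCount S m b n + + tail            ≡⟨ cong (_+_ (qCount S m b n)) (shift-pos (qpar S (not b) m) (suc m) n) ⟨
  qCount S m b n + shift (suc m) (qCount S m (not b)) n ∎
  where
  tail : ℕ
  tail = if suc m ≤ᵇ n then qpar S (not b) m (n ∸ suc m) else 0

pCount-skip : ∀ S m → S (suc m) ≡ false → ∀ b n → pCount S (suc m) b n ≡ pCount S m b n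
pCount-skip S m eq b n rewrite eq = refl

qCount-skip : ∀ S m → S (suc m) ≡ false → ∀ b n → qCount S (suc m) b n ≡ qCount S m b n
qCount-skip S m eq b n rewrite eq = cong +_ (ℕ.+-identityʳ _)

pCount-step : ∀ S b {m n} → n ≤ m → pCount S (suc m) b n ≡ pCount S m b n
pCount-step S b {m} {n} n≤m = bool-cases (S (suc m))
  (λ eq → pCount-skip S m eq b n)
  (λ eq → trans (pCount-suc S m eq b n) (+-shift-below (pCount S m b n) (pCount S (suc m) (not b)) (s≤s n≤m)))

qCount-step : ∀ S b {m n} → n ≤ m → qCount S (suc m) b n ≡ qCount S m b n
qCount-step S b {m} {n} n≤m = bool-cases (S (suc m))
  (λ eq → qCount-skip S m eq b n)
  (λ eq → trans (qCount-suc S m eq b n) (+-shift-below (qCount S m b n) (qCount S m (not b)) (s≤s n≤m)))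

signed : ℤ → (Bool → Series) → Series
signed s C n = C false n + s * C true n

-- Since s² = 1, s * signed s (D ∘ not) = signed s D: flipping the parity costs a factor s.
signed-shift : ∀ s → s * s ≡ 1ℤ → ∀ k C C′ D → (∀ b n → C′ b n ≡ C b n + shift k (D b) n) →
  ∀ n → signed s C′ n ≡ signed s C n + s * shift k (signed s (D ∘ not)) n
signed-shift s ss k C C′ D rec n = begin
  C′ false n + s * C′ true n
    ≡⟨ cong₂ (λ x y → x + s * y) (rec false n) (rec true n) ⟩
  (C false n + shift k (D false) n) + s * (C true n + shift k (D true) n)
    ≡⟨ swap-parity (C false n) (C true n) (shift k (D true) n) (shift k (D false) n) ⟩
  (C false n + s * C true n) + s * (shift k (D true) n + s * shift k (D false) n)
    ≡⟨ cong (λ x → signed s C n + s * x) (shift-linear (D true) s (D false) k n) ⟨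
  signed s C n + s * shift k (signed s (D ∘ not)) n ∎
  where
  expand : ∀ a a′ x x′ s → (a + x′) + s * (a′ + x) ≡ (a + s * a′) + s * x + 1ℤ * x′
  expand = solve-∀
  collect : ∀ a a′ x x′ s → (a + s * a′) + s * x + (s * s) * x′ ≡ (a + s * a′) + s * (x + s * x′)
  collect = solve-∀
  swap-parity : ∀ a a′ x x′ → (a + x′) + s * (a′ + x) ≡ (a + s * a′) + s * (x + s * x′)
  swap-parity a a′ x x′ = begin
    (a + x′) + s * (a′ + x)               ≡⟨ expand a a′ x x′ s ⟩
    (a + s * a′) + s * x + 1ℤ * x′        ≡⟨ cong (λ t → (a + s * a′) + s * x + t * x′) ss ⟨
    (a + s * a′) + s * x + (s * s) * x′   ≡⟨ collect a a′ x x′ s ⟩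
    (a + s * a′) + s * (x + s * x′)       ∎

-- For s² = 1 these are the truncated products ∏_{k∈S, k≤m} 1/(1 - s xᵏ) and ∏_{k∈S, k≤m} (1 + s xᵏ).
pSeries qSeries : Subset → ℤ → ℕ → Series
pSeries S s m = signed s (pCount S m)
qSeries S s m = signed s (qCount S m)

pSeries-zero : ∀ S s → pSeries S s 0 ≗ δ
pSeries-zero S s zero    = cong (_+_ 1ℤ) (*-zeroʳ s)
pSeries-zero S s (suc n) = trans (+-identityˡ _) (*-zeroʳ s)

qSeries-zero : ∀ S s → qSeries S s 0 ≗ δ
qSeries-zero S s zero    = cong (_+_ 1ℤ) (*-zeroʳ s)
qSeries-zero S s (suc n) = trans (+-identityˡ _) (*-zeroʳ s)

pSeries-skip : ∀ S m → S (suc m) ≡ false → ∀ s → pSeries S s (suc m) ≗ pSeries S s m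
pSeries-skip S m eq s n = cong₂ (λ x y → x + s * y) (pCount-skip S m eq false n) (pCount-skip S m eq true n)

qSeries-skip : ∀ S m → S (suc m) ≡ false → ∀ s → qSeries S s (suc m) ≗ qSeries S s m
qSeries-skip S m eq s n = cong₂ (λ x y → x + s * y) (qCount-skip S m eq false n) (qCount-skip S m eq true n)

pSeries-suc : ∀ s → s * s ≡ 1ℤ → ∀ S m → S (suc m) ≡ true →
  mulBinomial (- s) (suc m) (pSeries S s (suc m)) ≗ pSeries S s m
pSeries-suc s ss S m eq n = begin
  pSeries S s (suc m) n + - s * tail         ≡⟨ cong (_+ (- s * tail)) recurrence ⟩
  pSeries S s m n + s * tail + - s * tail    ≡⟨ cancel (pSeries S s m n) s tail ⟩
  pSeries S s m n                            ∎
  where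
  tail : ℤ
  tail = shift (suc m) (pSeries S s (suc m)) n
  recurrence : pSeries S s (suc m) n ≡ pSeries S s m n + s * tail
  recurrence = signed-shift s ss (suc m) (pCount S m) (pCount S (suc m)) (pCount S (suc m) ∘ not) (pCount-suc S m eq) n
  cancel : ∀ a s x → a + s * x + - s * x ≡ a
  cancel = solve-∀

qSeries-suc : ∀ s → s * s ≡ 1ℤ → ∀ S m → S (suc m) ≡ true →
  qSeries S s (suc m) ≗ mulBinomial s (suc m) (qSeries S s m)
qSeries-suc s ss S m eq =
  signed-shift s ss (suc m) (qCount S m) (qCount S (suc m)) (qCount S m ∘ not) (qCount-suc S m eq)

pSeries-step : ∀ S s {m n} → n ≤ m → pSeries S s (suc m) n ≡ pSeries S s m n
pSeries-step S s n≤m = cong₂ (λ x y → x + s * y) (pCount-step S false n≤m) (pCount-step S true n≤m)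

qSeries-step : ∀ S s {m n} → n ≤ m → qSeries S s (suc m) n ≡ qSeries S s m n
qSeries-step S s n≤m = cong₂ (λ x y → x + s * y) (qCount-step S false n≤m) (qCount-step S true n≤m)

pSeries-⊛-qSeries : ∀ s → s * s ≡ 1ℤ → ∀ S m → pSeries S s m ⊛ qSeries S (- s) m ≗ δ
pSeries-⊛-qSeries s ss S zero n =
  trans (⊛-cong (pSeries-zero S s) (qSeries-zero S (- s)) n) (⊛-identityˡ δ n)
pSeries-⊛-qSeries s ss S (suc m) n = bool-cases (S (suc m)) skip include
  where
  neg-square : ∀ s → - s * - s ≡ s * s
  neg-square = solve-∀
  skip : S (suc m) ≡ false → (pSeries S s (suc m) ⊛ qSeries S (- s) (suc m)) n ≡ δ n
  skip eq = trans (⊛-cong (pSeries-skip S m eq s) (qSeries-skip S m eq (- s)) n) (pSeries-⊛-qSeries s ss S m n)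
  include : S (suc m) ≡ true → (pSeries S s (suc m) ⊛ qSeries S (- s) (suc m)) n ≡ δ n
  include eq = begin
    (pSeries S s (suc m) ⊛ qSeries S (- s) (suc m)) n
      ≡⟨ ⊛-congʳ (pSeries S s (suc m)) (qSeries-suc (- s) (trans (neg-square s) ss) S m eq) n ⟩
    (pSeries S s (suc m) ⊛ mulBinomial (- s) (suc m) (qSeries S (- s) m)) n
      ≡⟨ ⊛-mulBinomial-swap (- s) (suc m) (pSeries S s (suc m)) (qSeries S (- s) m) n ⟨
    (mulBinomial (- s) (suc m) (pSeries S s (suc m)) ⊛ qSeries S (- s) m) n
      ≡⟨ ⊛-congˡ (qSeries S (- s) m) (pSeries-suc s ss S m eq) n ⟩
    (pSeries S s m ⊛ qSeries S (- s) m) n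
      ≡⟨ pSeries-⊛-qSeries s ss S m n ⟩
    δ n ∎

pSeries∞ qSeries∞ : Subset → ℤ → Series
pSeries∞ S s n = pSeries S s n n
qSeries∞ S s n = qSeries S s n n

pSeries∞-⊛-qSeries∞ : ∀ s → s * s ≡ 1ℤ → ∀ S → pSeries∞ S s ⊛ qSeries∞ S (- s) ≗ δ
pSeries∞-⊛-qSeries∞ s ss S n = trans (sumBelow-cong (suc n) truncate) (pSeries-⊛-qSeries s ss S n n)
  where
  truncate : i < suc n → pSeries∞ S s i * qSeries∞ S (- s) (n ∸ i) ≡ pSeries S s n i * qSeries S (- s) n (n ∸ i)
  truncate {i} (s≤s i≤n) =
    sym (cong₂ _*_ (stabilises (pSeries-step S s) i≤n) (stabilises (qSeries-step S (- s)) (ℕ.m∸n≤m n i)))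

pSeries∞-one : ∀ S n → pSeries∞ S 1ℤ n ≡ + p S n
pSeries∞-one S n = trans (cong (_+_ (+ pₑ S n)) (*-identityˡ (+ pₒ S n))) (sym (pos-+ (pₑ S n) (pₒ S n)))

qSeries∞-one : ∀ S n → qSeries∞ S 1ℤ n ≡ + q S n
qSeries∞-one S n = trans (cong (_+_ (+ qₑ S n)) (*-identityˡ (+ qₒ S n))) (sym (pos-+ (qₑ S n) (qₒ S n)))

pSeries∞-neg-one : ∀ S n → pSeries∞ S -1ℤ n ≡ + pₑ S n - + pₒ S n
pSeries∞-neg-one S n = cong (_+_ (+ pₑ S n)) (-1*i≡-i (+ pₒ S n))

qSeries∞-neg-one : ∀ S n → qSeries∞ S -1ℤ n ≡ + qₑ S n - + qₒ S n
qSeries∞-neg-one S n = cong (_+_ (+ qₑ S n)) (-1*i≡-i (+ qₒ S n))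

theorem3p2 : (S₁ S₂ : Subset) → EulerPair S₁ S₂ →
    ∀ (n : ℕ) → (+ qₑ S₂ n) - (+ qₒ S₂ n) ≡ (+ pₑ S₁ n) - (+ pₒ S₁ n)
theorem3p2 S₁ S₂ euler n = begin
  + qₑ S₂ n - + qₒ S₂ n
    ≡⟨ qSeries∞-neg-one S₂ n ⟨
  qSeries∞ S₂ -1ℤ n
    ≡⟨ ⊛-cancelʳ (qSeries∞ S₂ -1ℤ) (pSeries∞ S₁ -1ℤ) (qSeries∞ S₁ 1ℤ) refl same-product n ⟩
  pSeries∞ S₁ -1ℤ n
    ≡⟨ pSeries∞-neg-one S₁ n ⟩
  + pₑ S₁ n - + pₒ S₁ n ∎
  where
  euler′ : qSeries∞ S₁ 1ℤ ≗ pSeries∞ S₂ 1ℤ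
  euler′ m = begin
    qSeries∞ S₁ 1ℤ m  ≡⟨ qSeries∞-one S₁ m ⟩
    + q S₁ m          ≡⟨ cong +_ (euler m) ⟩
    + p S₂ m          ≡⟨ pSeries∞-one S₂ m ⟨
    pSeries∞ S₂ 1ℤ m  ∎
  p₁-inverse : pSeries∞ S₁ -1ℤ ⊛ qSeries∞ S₁ 1ℤ ≗ δ
  p₁-inverse = pSeries∞-⊛-qSeries∞ -1ℤ refl S₁
  q₂-inverse : qSeries∞ S₂ -1ℤ ⊛ qSeries∞ S₁ 1ℤ ≗ δ
  q₂-inverse m = begin
    (qSeries∞ S₂ -1ℤ ⊛ qSeries∞ S₁ 1ℤ) m  ≡⟨ ⊛-congʳ (qSeries∞ S₂ -1ℤ) euler′ m ⟩
    (qSeries∞ S₂ -1ℤ ⊛ pSeries∞ S₂ 1ℤ) m  ≡⟨ ⊛-comm (qSeries∞ S₂ -1ℤ) (pSeries∞ S₂ 1ℤ) m ⟩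
    (pSeries∞ S₂ 1ℤ ⊛ qSeries∞ S₂ -1ℤ) m  ≡⟨ pSeries∞-⊛-qSeries∞ 1ℤ refl S₂ m ⟩
    δ m                                   ∎
  same-product : qSeries∞ S₂ -1ℤ ⊛ qSeries∞ S₁ 1ℤ ≗ pSeries∞ S₁ -1ℤ ⊛ qSeries∞ S₁ 1ℤ
  same-product m = trans (q₂-inverse m) (sym (p₁-inverse m))
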